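{- Fix positive integers $k$ and $m\ge k!$. Then for every integer $n\ge k$, $F_k(n,m)\ge F_k(n+1,m)$.
   Context: $S_n$ is the set of permutations of $[n]$, viewed as linear orderings of $[n]$. For $P\in S_n$ and a $k$-element $X\subseteq[n]$, $P_X\in S_k$ is the pattern (relative order) of $X$ in $P$. A family $\mathcal S\subseteq S_n$ shatters $X$ if $\{P_X:P\in\mathcal S\}=S_k$. $F_k(n,m)$ is the largest $\alpha\in[0,1]$ such that some collection of exactly $m$ permutations from $S_n$ shatters $\alpha\binom nk$ of the $k$-element subsets of $[n]$. -}

module Defs where

open import Data.Nat using (ℕ; suc; _*_; _≤_)
open import Data.Fin using (Fin) renaming (_<_ to _<ᶠ_)
open import Data.Fin.Permutation using (Permutation′; _⟨$⟩ʳ_)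
open import Data.Vec using (Vec; lookup)
open import Data.List using (List; length)
open import Data.List.Relation.Unary.All using (All)
open import Data.List.Relation.Unary.Unique.Propositional using (Unique)
open import Data.Product using (Σ; ∃; _×_)
open import Function.Bundles using (_⇔_)
open import Relation.Binary.PropositionalEquality using (_≡_)

-- S_n : permutations of [n] = Fin n, viewed as linear orderings of Fin n:
-- P sends an element to its position, and a precedes b in P iff pos a < pos b.
Perm : ℕ → Set
Perm n = Permutation′ n

Precedes : ∀ {n} → Perm n → Fin n → Fin n → Set
Precedes P a b = (P ⟨$⟩ʳ a) <ᶠ (P ⟨$⟩ʳ b)

-- A k-element subset X of [n] is represented by the strictly increasing
-- enumeration x_0 < x_1 < ... < x_{k-1} of its elements.
IsKSubset : ∀ {n k} → Vec (Fin n) k → Set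
IsKSubset {k = k} x = ∀ (i j : Fin k) → i <ᶠ j → lookup x i <ᶠ lookup x j

PatternIs : ∀ {n k} → Perm n → Vec (Fin n) k → Perm k → Set
PatternIs {k = k} P x σ = ∀ (i j : Fin k) → Precedes P (lookup x i) (lookup x j) ⇔ Precedes σ i j

Shatters : ∀ {n k m} → Vec (Perm n) m → Vec (Fin n) k → Set
Shatters {k = k} {m = m} fam x = (σ : Perm k) → ∃ λ (t : Fin m) → PatternIs (lookup fam t) x σ

ShattersAtLeast : ∀ {n m} (k : ℕ) → Vec (Perm n) m → ℕ → Set
ShattersAtLeast {n} k fam s =
  ∃ λ (xs : List (Vec (Fin n) k)) →
    length xs ≡ s × Unique xs × All IsKSubset xs × All (Shatters fam) xs

-- F_k(n,m) ≥ F_k(n',m), unfolded: F_k(n,m) is the maximum over families of m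
-- permutations of (#shattered k-subsets)/C(n,k); the maximum is attained, so
-- the inequality says every family in S_{n'} shattering s' subsets is matched by
-- a family in S_n shattering s subsets with s/C(n,k) ≥ s'/C(n',k).
open import Data.Nat.Combinatorics using (_C_)

F-≥ : (k n n' m : ℕ) → Set
F-≥ k n n' m =
  (fam' : Vec (Perm n') m) (s' : ℕ) → ShattersAtLeast k fam' s' →
  Σ (Vec (Perm n) m) λ fam → ∃ λ s →
    ShattersAtLeast k fam s × s' * (n C k) ≤ s * (n' C k)

-- Given m permutations of [n+1] shattering s′ k-subsets, delete one point j from every
-- permutation.  A k-subset avoiding j keeps its pattern in each permutation, so it stays
-- shattered.  Each k-subset avoids n+1−k of the n+1 points, so some j is avoided by at
-- least s′(n+1−k)/(n+1) of the shattered subsets, and (n+1−k)·C(n+1,k) = (n+1)·C(n,k)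
-- turns this into s′/C(n+1,k) ≤ s/C(n,k).
module Submission where

open import Defs
open import Data.Nat using (ℕ; zero; suc; _+_; _*_; _∸_; _≤_; _!; z≤n; s≤s; s≤s⁻¹)
open import Data.Nat.Properties
  using ( +-identityʳ; *-identityʳ; *-zeroʳ; +-assoc; +-comm; *-distribˡ-+; +-∸-assoc
        ; m≤n⇒m∸n≡0; m∸n+n≡m; ≮⇒≥; _<?_; _≤?_; ≤-refl; ≤-trans; <⇒≤; <⇒≱; ≰⇒>; m≤n⇒m≤1+n
        ; +-mono-≤; +-monoʳ-≤; +-monoˡ-≤; *-monoʳ-≤; *-monoˡ-≤; +-cancelʳ-≤; *-cancelˡ-≤
        ; *-assoc; +-0-commutativeMonoid; +-commutativeSemigroup; *-commutativeSemigroup; module ≤-Reasoning )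
open import Data.Nat.Combinatorics using (_C_; nC1≡n; k>n⇒nCk≡0; nCk+nC[k+1]≡[n+1]C[k+1])
open import Data.Bool using (true; false; if_then_else_)
open import Data.Fin using (Fin; zero; suc; punchIn; punchOut; _≟_) renaming (_<_ to _<ᶠ_)
open import Data.Fin.Properties using (punchIn-mono-≤; punchIn-cancel-≤; punchIn-punchOut)
open import Data.Fin.Permutation using (_⟨$⟩ʳ_; remove; punchIn-permute)
open import Data.Vec as Vec using (Vec; []; _∷_; lookup; count)
open import Data.Vec.Properties using (lookup-map)
open import Data.Vec.Relation.Unary.All as VecAll using ([]; _∷_)
open import Data.List as List using (List; []; _∷_; length; filter)
open import Data.List.Properties using (length-map)
open import Data.List.Relation.Unary.All as All using ([]; _∷_)
open import Data.List.Relation.Unary.All.Properties as All using (all-filter)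
open import Data.List.Relation.Unary.Unique.Propositional using (Unique)
import Data.List.Relation.Unary.Unique.Propositional.Properties as Unique
open import Data.Product using (∃; _,_; map₂)
open import Function.Bundles using (_⇔_; mk⇔)
import Function.Properties.Equivalence as ⇔
open import Algebra.Properties.CommutativeMonoid.Sum +-0-commutativeMonoid
  using (sum; sum-syntax; ∑-distrib-+; sum-cong-≗; sum-replicate-zero)
open import Algebra.Properties.CommutativeSemigroup +-commutativeSemigroup using (interchange)
open import Algebra.Properties.CommutativeSemigroup *-commutativeSemigroup using (x∙yz≈y∙xz)
open import Relation.Binary.PropositionalEquality
open import Relation.Nullary using (Dec; does; yes; no; ¬?)
open import Relation.Unary using (Decidable)

[k+1]*[n+1]C[k+1]≡[n+1]*nCk : ∀ n k → suc k * (suc n C suc k) ≡ suc n * (n C k)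
[k+1]*[n+1]C[k+1]≡[n+1]*nCk n zero = begin
  suc n C 1 + 0   ≡⟨ +-identityʳ _ ⟩
  suc n C 1       ≡⟨ nC1≡n (suc n) ⟩
  suc n           ≡⟨ *-identityʳ (suc n) ⟨
  suc n * 1       ∎
  where open ≡-Reasoning
[k+1]*[n+1]C[k+1]≡[n+1]*nCk zero (suc k) = begin
  suc (suc k) * (1 C suc (suc k)) ≡⟨ cong (suc (suc k) *_) (k>n⇒nCk≡0 {1} {suc (suc k)} (s≤s (s≤s z≤n))) ⟩
  suc (suc k) * 0                 ≡⟨ *-zeroʳ (suc (suc k)) ⟩
  0                               ≡⟨ cong (_+ 0) (k>n⇒nCk≡0 {0} {suc k} (s≤s z≤n)) ⟨
  1 * (0 C suc k)                 ∎
  where open ≡-Reasoning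
[k+1]*[n+1]C[k+1]≡[n+1]*nCk (suc n) (suc k) = begin
  suc (suc k) * (suc (suc n) C suc (suc k))
    ≡⟨ cong (suc (suc k) *_) (nCk+nC[k+1]≡[n+1]C[k+1] (suc n) (suc k)) ⟨
  suc (suc k) * (a + b)
    ≡⟨ *-distribˡ-+ (suc (suc k)) a b ⟩
  (a + suc k * a) + suc (suc k) * b
    ≡⟨ +-assoc a (suc k * a) _ ⟩
  a + (suc k * a + suc (suc k) * b)
    ≡⟨ cong (a +_) (cong₂ _+_ ([k+1]*[n+1]C[k+1]≡[n+1]*nCk n k) ([k+1]*[n+1]C[k+1]≡[n+1]*nCk n (suc k))) ⟩
  a + (suc n * (n C k) + suc n * (n C suc k))
    ≡⟨ cong (a +_) (*-distribˡ-+ (suc n) (n C k) (n C suc k)) ⟨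
  a + suc n * (n C k + n C suc k)
    ≡⟨ cong (λ c → a + suc n * c) (nCk+nC[k+1]≡[n+1]C[k+1] n k) ⟩
  suc (suc n) * a ∎
  where
  open ≡-Reasoning
  a = suc n C suc k
  b = suc n C suc (suc k)

[n∸k]*nCk≡[k+1]*nC[k+1] : ∀ n k → (n ∸ k) * (n C k) ≡ suc k * (n C suc k)
[n∸k]*nCk≡[k+1]*nC[k+1] n k with k <? n
... | no k≮n = begin
  (n ∸ k) * (n C k)   ≡⟨ cong (_* (n C k)) (m≤n⇒m∸n≡0 (≮⇒≥ k≮n)) ⟩
  0                   ≡⟨ *-zeroʳ (suc k) ⟨
  suc k * 0           ≡⟨ cong (suc k *_) (k>n⇒nCk≡0 (s≤s (≮⇒≥ k≮n))) ⟨
  suc k * (n C suc k) ∎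
  where open ≡-Reasoning
[n∸k]*nCk≡[k+1]*nC[k+1] (suc n) zero | yes _ = begin
  suc n * 1       ≡⟨ *-identityʳ (suc n) ⟩
  suc n           ≡⟨ nC1≡n (suc n) ⟨
  suc n C 1       ≡⟨ +-identityʳ _ ⟨
  1 * (suc n C 1) ∎
  where open ≡-Reasoning
[n∸k]*nCk≡[k+1]*nC[k+1] (suc n) (suc k) | yes k+1<n+1 = begin
  (n ∸ k) * (suc n C suc k)
    ≡⟨ cong ((n ∸ k) *_) (nCk+nC[k+1]≡[n+1]C[k+1] n k) ⟨
  (n ∸ k) * (a + b)
    ≡⟨ *-distribˡ-+ (n ∸ k) a b ⟩
  (n ∸ k) * a + (n ∸ k) * b
    ≡⟨ cong₂ (λ u v → u + v * b) ([n∸k]*nCk≡[k+1]*nC[k+1] n k) (+-∸-assoc 1 (s≤s⁻¹ k+1<n+1)) ⟩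
  suc k * b + (b + (n ∸ suc k) * b)
    ≡⟨ cong (λ u → suc k * b + (b + u)) ([n∸k]*nCk≡[k+1]*nC[k+1] n (suc k)) ⟩
  suc k * b + (b + suc (suc k) * c)
    ≡⟨ +-assoc (suc k * b) b _ ⟨
  (suc k * b + b) + suc (suc k) * c
    ≡⟨ cong (_+ suc (suc k) * c) (+-comm (suc k * b) b) ⟩
  suc (suc k) * b + suc (suc k) * c
    ≡⟨ *-distribˡ-+ (suc (suc k)) b c ⟨
  suc (suc k) * (b + c)
    ≡⟨ cong (suc (suc k) *_) (nCk+nC[k+1]≡[n+1]C[k+1] n (suc k)) ⟩
  suc (suc k) * (suc n C suc (suc k)) ∎
  where
  open ≡-Reasoning
  a = n C k
  b = n C suc k
  c = n C suc (suc k)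

[n+1∸k]*[n+1]Ck≡[n+1]*nCk : ∀ n k → (suc n ∸ k) * (suc n C k) ≡ suc n * (n C k)
[n+1∸k]*[n+1]Ck≡[n+1]*nCk n k =
  trans ([n∸k]*nCk≡[k+1]*nC[k+1] (suc n) k) ([k+1]*[n+1]C[k+1]≡[n+1]*nCk n k)

indicator : ∀ {p} {P : Set p} → Dec P → ℕ
indicator P? = if does P? then 1 else 0

count-∷ : ∀ {a p} {A : Set a} {P : A → Set p} (P? : Decidable P) x {k} (xs : Vec A k) →
  count P? (x ∷ xs) ≡ indicator (P? x) + count P? xs
count-∷ P? x xs with does (P? x)
... | true  = refl
... | false = refl

length-filter-∷ : ∀ {a p} {A : Set a} {P : A → Set p} (P? : Decidable P) x (xs : List A) →
  length (filter P? (x ∷ xs)) ≡ indicator (P? x) + length (filter P? xs)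
length-filter-∷ P? x xs with does (P? x)
... | true  = refl
... | false = refl

sum-mono-≤ : ∀ {n} {f g : Fin n → ℕ} → (∀ j → f j ≤ g j) → sum f ≤ sum g
sum-mono-≤ {zero}  f≤g = z≤n
sum-mono-≤ {suc n} f≤g = +-mono-≤ (f≤g zero) (sum-mono-≤ (λ j → f≤g (suc j)))

∑1≡n : ∀ n → ∑[ j < n ] 1 ≡ n
∑1≡n zero    = refl
∑1≡n (suc n) = cong suc (∑1≡n n)

∑-indicator-≟ : ∀ {n} (a : Fin n) → ∑[ j < n ] indicator (j ≟ a) ≡ 1
∑-indicator-≟ {suc n} zero    = cong suc (sum-replicate-zero n)
∑-indicator-≟ {suc n} (suc a) = ∑-indicator-≟ a

∑-count-≟ : ∀ {n k} (x : Vec (Fin n) k) → ∑[ j < n ] count (j ≟_) x ≡ k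
∑-count-≟ {n} [] = sum-replicate-zero n
∑-count-≟ {n} (a ∷ x) = begin
  ∑[ j < n ] count (j ≟_) (a ∷ x)                               ≡⟨ sum-cong-≗ (λ j → count-∷ (j ≟_) a x) ⟩
  ∑[ j < n ] (indicator (j ≟ a) + count (j ≟_) x)               ≡⟨ ∑-distrib-+ (λ j → indicator (j ≟ a)) (λ j → count (j ≟_) x) ⟩
  ∑[ j < n ] indicator (j ≟ a) + ∑[ j < n ] count (j ≟_) x      ≡⟨ cong₂ _+_ (∑-indicator-≟ a) (∑-count-≟ x) ⟩
  suc _                                                         ∎
  where open ≡-Reasoning

∃-sum≤[n+1]*term : ∀ n (f : Fin (suc n) → ℕ) → ∃ λ j → sum f ≤ suc n * f j
∃-sum≤[n+1]*term zero f = zero , ≤-refl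
∃-sum≤[n+1]*term (suc n) f with ∃-sum≤[n+1]*term n (λ j → f (suc j))
... | j , sum≤ with f zero ≤? f (suc j)
...   | yes f0≤fj = suc j , +-mono-≤ f0≤fj sum≤
...   | no f0≰fj  = zero , +-monoʳ-≤ (f zero) (≤-trans sum≤ (*-monoʳ-≤ (suc n) (<⇒≤ (≰⇒> f0≰fj))))

Avoids : ∀ {n k} → Fin n → Vec (Fin n) k → Set
Avoids j = VecAll.All (j ≢_)

avoids? : ∀ {n k} (j : Fin n) → Decidable (Avoids {k = k} j)
avoids? j = VecAll.all? (λ a → ¬? (j ≟ a))

avoiding : ∀ {n k} → Fin n → List (Vec (Fin n) k) → List (Vec (Fin n) k)
avoiding j = filter (avoids? j)

avoids-or-occurs : ∀ {n k} (j : Fin n) (x : Vec (Fin n) k) → 1 ≤ indicator (avoids? j x) + count (j ≟_) x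
avoids-or-occurs j [] = s≤s z≤n
avoids-or-occurs j (a ∷ x) with does (j ≟ a)
... | true  = s≤s z≤n
... | false = avoids-or-occurs j x

n≤∑avoids+k : ∀ {n k} (x : Vec (Fin n) k) → n ≤ ∑[ j < n ] indicator (avoids? j x) + k
n≤∑avoids+k {n} {k} x = begin
  n                                                               ≡⟨ ∑1≡n n ⟨
  ∑[ j < n ] 1                                                    ≤⟨ sum-mono-≤ (λ j → avoids-or-occurs j x) ⟩
  ∑[ j < n ] (indicator (avoids? j x) + count (j ≟_) x)           ≡⟨ ∑-distrib-+ (λ j → indicator (avoids? j x)) (λ j → count (j ≟_) x) ⟩
  ∑[ j < n ] indicator (avoids? j x) + ∑[ j < n ] count (j ≟_) x  ≡⟨ cong (∑[ j < n ] indicator (avoids? j x) +_) (∑-count-≟ x) ⟩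
  ∑[ j < n ] indicator (avoids? j x) + k                          ∎
  where open ≤-Reasoning

length*n≤∑length-avoiding+length*k : ∀ {n k} (xs : List (Vec (Fin n) k)) →
  length xs * n ≤ ∑[ j < n ] length (avoiding j xs) + length xs * k
length*n≤∑length-avoiding+length*k [] = z≤n
length*n≤∑length-avoiding+length*k {n} {k} (x ∷ xs) = begin
  n + length xs * n
    ≤⟨ +-mono-≤ (n≤∑avoids+k x) (length*n≤∑length-avoiding+length*k xs) ⟩
  (a + k) + (t + length xs * k)
    ≡⟨ interchange a k t _ ⟩
  (a + t) + (k + length xs * k)
    ≡⟨ cong (_+ _) (∑-distrib-+ (λ j → indicator (avoids? j x)) (λ j → length (avoiding j xs))) ⟨
  ∑[ j < n ] (indicator (avoids? j x) + length (avoiding j xs)) + (k + length xs * k)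
    ≡⟨ cong (_+ _) (sum-cong-≗ (λ j → length-filter-∷ (avoids? j) x xs)) ⟨
  ∑[ j < n ] length (avoiding j (x ∷ xs)) + (k + length xs * k) ∎
  where
  open ≤-Reasoning
  a = ∑[ j < n ] indicator (avoids? j x)
  t = ∑[ j < n ] length (avoiding j xs)

∃-length*[n+1∸k]≤[n+1]*length-avoiding : ∀ {n k} → k ≤ suc n → (xs : List (Vec (Fin (suc n)) k)) →
  ∃ λ j → length xs * (suc n ∸ k) ≤ suc n * length (avoiding j xs)
∃-length*[n+1∸k]≤[n+1]*length-avoiding {n} {k} k≤n+1 xs =
  map₂ (λ {j} ∑≤ → +-cancelʳ-≤ (l * k) _ _ (begin
    l * (suc n ∸ k) + l * k                          ≡⟨ *-distribˡ-+ l (suc n ∸ k) k ⟨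
    l * (suc n ∸ k + k)                              ≡⟨ cong (l *_) (m∸n+n≡m k≤n+1) ⟩
    l * suc n                                        ≤⟨ length*n≤∑length-avoiding+length*k xs ⟩
    ∑[ i < suc n ] length (avoiding i xs) + l * k    ≤⟨ +-monoˡ-≤ (l * k) ∑≤ ⟩
    suc n * length (avoiding j xs) + l * k           ∎))
  (∃-sum≤[n+1]*term n (λ j → length (avoiding j xs)))
  where
  open ≤-Reasoning
  l = length xs

punchIn-mono-< : ∀ {n} i {a b : Fin n} → a <ᶠ b → punchIn i a <ᶠ punchIn i b
punchIn-mono-< i {a} {b} a<b = ≰⇒> (λ ib≤ia → <⇒≱ a<b (punchIn-cancel-≤ i b a ib≤ia))

punchIn-cancel-< : ∀ {n} i {a b : Fin n} → punchIn i a <ᶠ punchIn i b → a <ᶠ b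
punchIn-cancel-< i {a} {b} ia<ib = ≰⇒> (λ b≤a → <⇒≱ ia<ib (punchIn-mono-≤ i b a b≤a))

Precedes-remove : ∀ {n} (P : Perm (suc n)) i {a b} →
  Precedes (remove i P) a b ⇔ Precedes P (punchIn i a) (punchIn i b)
Precedes-remove P i {a} {b} =
  subst₂ (λ u v → Precedes (remove i P) a b ⇔ u <ᶠ v)
    (sym (punchIn-permute P i a)) (sym (punchIn-permute P i b))
    (mk⇔ (punchIn-mono-< (P ⟨$⟩ʳ i)) (punchIn-cancel-< (P ⟨$⟩ʳ i)))

PatternIs-remove : ∀ {n k} (P : Perm (suc n)) i (x : Vec (Fin n) k) {σ : Perm k} →
  PatternIs P (Vec.map (punchIn i) x) σ → PatternIs (remove i P) x σ
PatternIs-remove P i x {σ} patt a b =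
  ⇔.trans (Precedes-remove P i)
    (subst₂ (λ u v → Precedes P u v ⇔ Precedes σ a b) (lookup-map a _ x) (lookup-map b _ x) (patt a b))

IsKSubset-punchIn⁻ : ∀ {n k} i (x : Vec (Fin n) k) → IsKSubset (Vec.map (punchIn i) x) → IsKSubset x
IsKSubset-punchIn⁻ i x increasing a b a<b =
  punchIn-cancel-< i (subst₂ _<ᶠ_ (lookup-map a (punchIn i) x) (lookup-map b (punchIn i) x) (increasing a b a<b))

Shatters-remove : ∀ {n k m} (fam : Vec (Perm (suc n)) m) i (x : Vec (Fin n) k) →
  Shatters fam (Vec.map (punchIn i) x) → Shatters (Vec.map (remove i) fam) x
Shatters-remove fam i x shatters σ = map₂ transport (shatters σ)
  where
  transport : ∀ {t} → PatternIs (lookup fam t) (Vec.map (punchIn i) x) σ →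
    PatternIs (lookup (Vec.map (remove i) fam) t) x σ
  transport {t} patt = subst (λ P → PatternIs P x σ) (sym (lookup-map t (remove i) fam))
    (PatternIs-remove (lookup fam t) i x {σ} patt)

punchOutᵛ : ∀ {n k} {j : Fin (suc n)} {x : Vec (Fin (suc n)) k} → Avoids j x → Vec (Fin n) k
punchOutᵛ []       = []
punchOutᵛ (p ∷ ps) = punchOut p ∷ punchOutᵛ ps

map-punchIn-punchOutᵛ : ∀ {n k} {j : Fin (suc n)} {x : Vec (Fin (suc n)) k} (ps : Avoids j x) →
  Vec.map (punchIn j) (punchOutᵛ ps) ≡ x
map-punchIn-punchOutᵛ []       = refl
map-punchIn-punchOutᵛ (p ∷ ps) = cong₂ _∷_ (punchIn-punchOut p) (map-punchIn-punchOutᵛ ps)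

punchOutᴸ : ∀ {n k} {j : Fin (suc n)} {xs : List (Vec (Fin (suc n)) k)} →
  All.All (Avoids j) xs → List (Vec (Fin n) k)
punchOutᴸ []       = []
punchOutᴸ (p ∷ ps) = punchOutᵛ p ∷ punchOutᴸ ps

map-punchIn-punchOutᴸ : ∀ {n k} {j : Fin (suc n)} {xs : List (Vec (Fin (suc n)) k)}
  (ps : All.All (Avoids j) xs) → List.map (Vec.map (punchIn j)) (punchOutᴸ ps) ≡ xs
map-punchIn-punchOutᴸ []       = refl
map-punchIn-punchOutᴸ (p ∷ ps) = cong₂ _∷_ (map-punchIn-punchOutᵛ p) (map-punchIn-punchOutᴸ ps)

ShattersAtLeast-remove : ∀ {n k m} (fam : Vec (Perm (suc n)) m) (j : Fin (suc n))
  (xs : List (Vec (Fin (suc n)) k)) → Unique xs → All.All IsKSubset xs → All.All (Shatters fam) xs →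
  ShattersAtLeast k (Vec.map (remove j) fam) (length (avoiding j xs))
ShattersAtLeast-remove fam j xs unique subsets shattered =
  ys , length-ys , Unique.map⁻ (subst Unique (sym ys↑) (Unique.filter⁺ (avoids? j) unique)) ,
  All.map (λ {y} → IsKSubset-punchIn⁻ j y) (lift subsets) ,
  All.map (λ {y} → Shatters-remove fam j y) (lift shattered)
  where
  ys : List (Vec (Fin _) _)
  ys = punchOutᴸ (all-filter (avoids? j) xs)
  ys↑ : List.map (Vec.map (punchIn j)) ys ≡ avoiding j xs
  ys↑ = map-punchIn-punchOutᴸ (all-filter (avoids? j) xs)
  length-ys : length ys ≡ length (avoiding j xs)
  length-ys = trans (sym (length-map _ ys)) (cong length ys↑)
  lift : ∀ {Q} → All.All Q xs → All.All (λ y → Q (Vec.map (punchIn j) y)) ys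
  lift qs = All.map⁻ (subst (All.All _) (sym ys↑) (All.filter⁺ (avoids? j) qs))

*nCk≤*[n+1]Ck : ∀ n k s s′ → s′ * (suc n ∸ k) ≤ suc n * s → s′ * (n C k) ≤ s * (suc n C k)
*nCk≤*[n+1]Ck n k s s′ s′[n+1∸k]≤[n+1]s = *-cancelˡ-≤ (suc n) (begin
  suc n * (s′ * (n C k))         ≡⟨ x∙yz≈y∙xz (suc n) s′ (n C k) ⟩
  s′ * (suc n * (n C k))         ≡⟨ cong (s′ *_) ([n+1∸k]*[n+1]Ck≡[n+1]*nCk n k) ⟨
  s′ * ((suc n ∸ k) * (suc n C k)) ≡⟨ *-assoc s′ (suc n ∸ k) _ ⟨
  s′ * (suc n ∸ k) * (suc n C k) ≤⟨ *-monoˡ-≤ (suc n C k) s′[n+1∸k]≤[n+1]s ⟩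
  suc n * s * (suc n C k)        ≡⟨ *-assoc (suc n) s _ ⟩
  suc n * (s * (suc n C k))      ∎)
  where open ≤-Reasoning

theorem3p1 : (k m : ℕ) → 1 ≤ k → k ! ≤ m →
    (n : ℕ) → k ≤ n → F-≥ k n (suc n) m
theorem3p1 k m _ _ n k≤n fam′ s′ (xs , refl , unique , subsets , shattered) =
  let j , bound = ∃-length*[n+1∸k]≤[n+1]*length-avoiding (m≤n⇒m≤1+n k≤n) xs in
  Vec.map (remove j) fam′ , length (avoiding j xs) ,
  ShattersAtLeast-remove fam′ j xs unique subsets shattered ,
  *nCk≤*[n+1]Ck n k (length (avoiding j xs)) (length xs) bound
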